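{- Let $n\ge 1$, let $S\subseteq \{1,2,\ldots,\lfloor n/2\rfloor\}$, and let $G=C_n(S)$. If there exists $a\in S$ whose additive order $k=\operatorname{ord}(a)$ in $\mathbb{Z}_n$ satisfies $k\geq 4$ and such that $\gcd(a,n)\notin S$, then $G$ is not chordal.
   Context: For $S\subseteq T:=\{1,2,\ldots,\lfloor n/2\rfloor\}$, the circulant graph $C_n(S)$ has vertex set $\mathbb{Z}_n=\{0,\ldots,n-1\}$ and edge set $\{\{i,j\} : |j-i|_n\in S\}$, where $|k|_n=\min\{|k|,n-|k|\}$. $\operatorname{ord}(a)=n/\gcd(a,n)$ is the additive order of $a$ in $\mathbb{Z}_n$. A graph is chordal if every cycle of length at least $4$ has a chord, i.e. an edge not in the cycle joining two of its vertices. -}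

module Defs where

open import Data.Nat using (ℕ; zero; suc; _+_; _*_; _∸_; _≤_; _<_; _⊔_; _⊓_; ∣_-_∣; _/_)
open import Data.Nat.Divisibility using (_∣_; quotient)
open import Data.Nat.GCD using (gcd; gcd[m,n]∣n)
open import Data.Product using (Σ; ∃; _×_; _,_)
open import Data.Sum using (_⊎_)
open import Relation.Nullary using (¬_)
open import Relation.Binary.PropositionalEquality using (_≡_; _≢_)

_⊆T_ : (S : ℕ → Set) → ℕ → Set
S ⊆T n = ∀ x → S x → 1 ≤ x × x ≤ n / 2

cdist : ℕ → ℕ → ℕ → ℕ
cdist n i j = ∣ j - i ∣ ⊓ (n ∸ ∣ j - i ∣)

-- adjacency in the circulant graph C_n(S) (vertex set {0,…,n-1})
Adj : ℕ → (ℕ → Set) → ℕ → ℕ → Set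
Adj n S i j = S (cdist n i j)

-- additive order of a in ℤ_n : n / gcd(a,n)  (as the cofactor of gcd(a,n) in n)
ord : ℕ → ℕ → ℕ
ord n a = quotient (gcd[m,n]∣n a n)

Consec : ℕ → ℕ → ℕ → Set
Consec m i j = (j ≡ suc i) ⊎ (i ≡ m ∸ 1 × j ≡ 0)

IsCycle : ℕ → (ℕ → Set) → ℕ → (ℕ → ℕ) → Set
IsCycle n S m v =
  (∀ i → i < m → v i < n) ×
  (∀ i j → i < m → j < m → v i ≡ v j → i ≡ j) ×
  (∀ i j → i < m → j < m → Consec m i j → Adj n S (v i) (v j))

HasChord : ℕ → (ℕ → Set) → ℕ → (ℕ → ℕ) → Set
HasChord n S m v = Σ ℕ λ i → Σ ℕ λ j →
  i < m × j < m × i ≢ j × ¬ Consec m i j × ¬ Consec m j i × Adj n S (v i) (v j)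

Chordal : ℕ → (ℕ → Set) → Set
Chordal n S = ∀ m → 4 ≤ m → (v : ℕ → ℕ) → IsCycle n S m v → HasChord n S m v

module Submission where

-- The multiples 0, a, 2a, …, (k-1)a are k distinct vertices, and for indices
-- x ≤ y < k the vertices xa and ya are adjacent exactly when y - x lies in
-- D = {δ : |δa|ₙ ∈ S}.  So an increasing sequence of indices 0 = w₀ < … < w_r < k
-- whose consecutive differences (and w_r itself) lie in D, while all other
-- differences do not, is a chordless cycle of Cₙ(S) ("chordless index cycle").
-- A purely combinatorial argument about a set D ⊆ ℕ shows: if there is no
-- chordless index cycle, 1 ∈ D and k-1 ∈ D, then every index in [1, k) lies in
-- D.  (Let m be the first index missing from D and t > m the next one in D;
-- then 0, t-m, m, t (if t < 2m) or 0, s, 2s, …, qs, t with s = m-1 (otherwise)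
-- is a chordless index cycle.)  Finally a ∈ S gives 1 ∈ D and, as
-- |(k-1)a|ₙ = |a|ₙ, also k-1 ∈ D; by Bézout d ≡ ±xa (mod n), so j = x mod k is
-- an index in [1, k) with |ja|ₙ = d ∉ S, a contradiction.
--
-- Since S
-- is an arbitrary (undecidable) predicate, the combinatorial statement is
-- proved in double-negated form, which suffices to derive a contradiction.

open import Defs
open import Data.Nat using (ℕ; zero; suc; _+_; _*_; _∸_; _≤_; _<_; _⊓_; ∣_-_∣; _/_; _%_;
  NonZero; >-nonZero; >-nonZero⁻¹; ≢-nonZero; ≢-nonZero⁻¹; z≤n; s≤s; _<?_; _≤?_)
open import Data.Nat.Properties
open import Data.Nat.DivMod
open import Data.Nat.Divisibility using (_∣_; divides-refl; n∣m⇒m%n≡0; m%n≡0⇒n∣m; *-cancelʳ-∣; *-monoʳ-∣; ∣⇒≤; ∣n⇒∣m*n; n∣m*n)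
open import Data.Nat.GCD using (gcd; gcd[m,n]∣m; gcd[m,n]∣n; gcd-GCD; gcd-greatest; c*gcd[m,n]≡gcd[cm,cn]; module Bézout)
open import Data.Nat.Induction using (<-rec)
open import Data.Product using (Σ; Σ-syntax; ∃-syntax; _×_; _,_; proj₁; proj₂)
open import Data.Sum using (inj₁; inj₂)
open import Data.Empty using (⊥-elim)
open import Relation.Nullary using (¬_; yes; no)
open import Relation.Binary.Definitions using (tri<; tri≈; tri>)
open import Relation.Binary.PropositionalEquality

-- Membership in T = {1, …, ⌊n/2⌋} bounds an element by half of n; this is what
-- makes |a|ₙ = a for a ∈ S.
≤half⇒double≤ : ∀ {x n} → x ≤ n / 2 → x + x ≤ n
≤half⇒double≤ {x} {n} x≤n/2 =
  subst (_≤ n) (trans (*-comm x 2) (cong (x +_) (+-identityʳ x)))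
    (≤-trans (*-monoˡ-≤ 2 x≤n/2) (m/n*n≤m n 2))

step-increasing⇒increasing : (w : ℕ → ℕ) (r : ℕ) → (∀ i → i < r → w i < w (suc i)) →
  ∀ {i j} → i < j → j ≤ r → w i < w j
step-increasing⇒increasing w r step {i} {suc j} (s≤s i≤j) j+1≤r with m≤n⇒m<n∨m≡n i≤j
... | inj₁ i<j = <-trans (step-increasing⇒increasing w r step i<j (<⇒≤ j+1≤r)) (step j j+1≤r)
... | inj₂ refl = step i j+1≤r

module CircularDistance (n : ℕ) .{{_ : NonZero n}} where

  wrap : ℕ → ℕ
  wrap x = x ⊓ (n ∸ x)

  cdist-from-0 : ∀ u → cdist n 0 u ≡ wrap u
  cdist-from-0 u = cong wrap (∣-∣-identityʳ u)

  cdist-sym : ∀ x y → cdist n x y ≡ cdist n y x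
  cdist-sym x y = cong wrap (∣-∣-comm y x)

  cdist-self : ∀ x → cdist n x x ≡ 0
  cdist-self x = cong wrap (∣n-n∣≡0 x)

  wrap-flip : ∀ u → u ≤ n → wrap (n ∸ u) ≡ wrap u
  wrap-flip u u≤n = trans (cong ((n ∸ u) ⊓_) (m∸[m∸n]≡n u≤n)) (⊓-comm (n ∸ u) u)

  wrap-small : ∀ u → u + u ≤ n → wrap u ≡ u
  wrap-small u 2u≤n = m≤n⇒m⊓n≡m (m+n≤o⇒m≤o∸n u 2u≤n)

  wrap-zero : ∀ u → u < n → wrap u ≡ 0 → u ≡ 0
  wrap-zero u u<n wrap≡0 with ≤-total u (n ∸ u)
  ... | inj₁ u≤n-u = trans (sym (m≤n⇒m⊓n≡m u≤n-u)) wrap≡0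
  ... | inj₂ n-u≤u = ⊥-elim (<⇒≱ u<n (m∸n≡0⇒m≤n (trans (sym (m≥n⇒m⊓n≡n n-u≤u)) wrap≡0)))

  cdist-rotate : ∀ p u → p < n → u < n → cdist n p ((p + u) % n) ≡ wrap u
  cdist-rotate p u p<n u<n with p + u <? n
  ... | yes p+u<n = begin
      wrap ∣ (p + u) % n - p ∣ ≡⟨ cong (λ z → wrap ∣ z - p ∣) (m<n⇒m%n≡m p+u<n) ⟩
      wrap ∣ p + u - p ∣       ≡⟨ cong wrap (trans (m≤n⇒∣n-m∣≡n∸m (m≤m+n p u)) (m+n∸m≡n p u)) ⟩
      wrap u                   ∎
    where open ≡-Reasoning
  ... | no p+u≮n = begin
      wrap ∣ (p + u) % n - p ∣ ≡⟨ cong (λ z → wrap ∣ z - p ∣) wrapped ⟩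
      wrap ∣ q - p ∣           ≡⟨ cong wrap (m≤n⇒∣m-n∣≡n∸m q≤p) ⟩
      wrap (p ∸ q)             ≡⟨ cong wrap p∸q≡n∸u ⟩
      wrap (n ∸ u)             ≡⟨ wrap-flip u (<⇒≤ u<n) ⟩
      wrap u                   ∎
    where
    open ≡-Reasoning
    n≤p+u : n ≤ p + u
    n≤p+u = ≮⇒≥ p+u≮n
    -- the reduced sum, which lies before p on the cycle, n - u steps back
    q = p + u ∸ n
    q<n : q < n
    q<n = +-cancelʳ-< n q n (subst (_< n + n) (sym (m∸n+n≡m n≤p+u)) (+-mono-< p<n u<n))
    wrapped : (p + u) % n ≡ q
    wrapped = trans (sym (m≤n⇒[n∸m]%m≡n%m n≤p+u)) (m<n⇒m%n≡m q<n)
    p≡q+[n∸u] : p ≡ q + (n ∸ u)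
    p≡q+[n∸u] = +-cancelʳ-≡ u p (q + (n ∸ u)) (begin
       p + u           ≡⟨ sym (m∸n+n≡m n≤p+u) ⟩
       q + n           ≡⟨ cong (q +_) (sym (m∸n+n≡m (<⇒≤ u<n))) ⟩
       q + (n ∸ u + u) ≡⟨ sym (+-assoc q (n ∸ u) u) ⟩
       q + (n ∸ u) + u ∎)
    q≤p : q ≤ p
    q≤p = subst (q ≤_) (sym p≡q+[n∸u]) (m≤m+n q (n ∸ u))
    p∸q≡n∸u : p ∸ q ≡ n ∸ u
    p∸q≡n∸u = trans (cong (_∸ q) p≡q+[n∸u]) (m+n∸m≡n q (n ∸ u))

-- Indices δ < k stand for the multiples δa of a generator of order k; P δ says
-- that two multiples whose indices differ by δ are adjacent.
module IndexCycles (P : ℕ → Set) (k : ℕ) where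

  record ChordlessCycle (r : ℕ) (w : ℕ → ℕ) : Set where
    field
      starts-at-0 : w 0 ≡ 0
      increasing  : ∀ i → i < r → w i < w (suc i)
      bounded     : w r < k
      edge        : ∀ i → i < r → P (w (suc i) ∸ w i)
      closing     : P (w r)
      chordless   : ∀ i j → 2 + i ≤ j → j ≤ r → (i ≡ 0 → j ≢ r) → ¬ P (w j ∸ w i)

  NoChordlessCycle : Set
  NoChordlessCycle = ∀ r → 3 ≤ r → (w : ℕ → ℕ) → ¬ ChordlessCycle r w

  Below : ℕ → Set
  Below m = ∀ i → 1 ≤ i → i < m → P i

  Gap : ℕ → ℕ → Set
  Gap m t = ∀ i → m ≤ i → i < t → ¬ P i

  extend : ∀ {m} → Below m → P m → Below (suc m)
  extend below Pm i 1≤i (s≤s i≤m) with m≤n⇒m<n∨m≡n i≤m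
  ... | inj₁ i<m = below i 1≤i i<m
  ... | inj₂ refl = Pm

  square-chordless : (w : ℕ → ℕ) → ¬ P (w 2 ∸ w 0) → ¬ P (w 3 ∸ w 1) →
    ∀ i j → 2 + i ≤ j → j ≤ 3 → (i ≡ 0 → j ≢ 3) → ¬ P (w j ∸ w i)
  square-chordless w ¬P02 ¬P13 0 2 _ _ _ = ¬P02
  square-chordless w ¬P02 ¬P13 0 3 _ _ not-closing = ⊥-elim (not-closing refl refl)
  square-chordless w ¬P02 ¬P13 1 3 _ _ _ = ¬P13
  square-chordless w ¬P02 ¬P13 0 0 () _ _
  square-chordless w ¬P02 ¬P13 0 1 (s≤s ()) _ _
  square-chordless w ¬P02 ¬P13 0 (suc (suc (suc (suc _)))) _ (s≤s (s≤s (s≤s ()))) _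
  square-chordless w ¬P02 ¬P13 1 0 () _ _
  square-chordless w ¬P02 ¬P13 1 1 (s≤s ()) _ _
  square-chordless w ¬P02 ¬P13 1 2 (s≤s (s≤s ())) _ _
  square-chordless w ¬P02 ¬P13 1 (suc (suc (suc (suc _)))) _ (s≤s (s≤s (s≤s ()))) _
  square-chordless w ¬P02 ¬P13 (suc (suc i)) j 4+i≤j j≤3 _ =
    ⊥-elim (<⇒≱ (≤-trans (s≤s (s≤s (s≤s (s≤s z≤n)))) 4+i≤j) j≤3)

  -- The run 0, s, 2s, …, qs, t with qs < t ≤ (q+1)s: its sides are s and
  -- t - qs ≤ s, and indices two or more steps apart are at distance ≥ s + 1.
  module Run (s q t : ℕ) .{{_ : NonZero s}} (qs<t : q * s < t) (t≤s+qs : t ≤ s + q * s) where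

    0<s : 0 < s
    0<s = >-nonZero⁻¹ s

    w : ℕ → ℕ
    w i = i * s ⊓ t

    w-inner : ∀ {i} → i ≤ q → w i ≡ i * s
    w-inner i≤q = m≤n⇒m⊓n≡m (<⇒≤ (≤-<-trans (*-monoˡ-≤ s i≤q) qs<t))

    w-last : w (suc q) ≡ t
    w-last = m≥n⇒m⊓n≡n t≤s+qs

    increasing : ∀ i → i < suc q → w i < w (suc i)
    increasing i (s≤s i≤q) with m≤n⇒m<n∨m≡n i≤q
    ... | inj₁ i<q = subst₂ _<_ (sym (w-inner i≤q)) (sym (w-inner i<q)) (m<n+m (i * s) 0<s)
    ... | inj₂ refl = subst₂ _<_ (sym (w-inner i≤q)) (sym w-last) qs<t

    module _ (below : Below (suc s)) (gap : Gap (suc s) t) where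

      edge : ∀ i → i < suc q → P (w (suc i) ∸ w i)
      edge i (s≤s i≤q) with m≤n⇒m<n∨m≡n i≤q
      ... | inj₁ i<q = subst P (sym (trans (cong₂ _∸_ (w-inner i<q) (w-inner i≤q)) (m+n∸n≡m s (i * s))))
                         (below s 0<s (n<1+n s))
      ... | inj₂ refl = subst P (sym (cong₂ _∸_ w-last (w-inner i≤q)))
                         (below (t ∸ q * s) (m<n⇒0<n∸m qs<t)
                           (s≤s (m≤n+o⇒m∸n≤o t (q * s) (subst (t ≤_) (+-comm s (q * s)) t≤s+qs))))

      inner-chordless : ∀ i j → 2 + i ≤ j → j ≤ q → ¬ P (j * s ∸ i * s)
      inner-chordless i j 2+i≤j j≤q = gap (j * s ∸ i * s) (m+n≤o⇒m≤o∸n (suc s) m+is≤js)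
        (≤-<-trans (m∸n≤m (j * s) (i * s)) (≤-<-trans (*-monoˡ-≤ s j≤q) qs<t))
        where
        m+is≤js : suc s + i * s ≤ j * s
        m+is≤js = ≤-trans (+-monoˡ-≤ (i * s) (+-monoˡ-≤ s 0<s))
                    (subst (_≤ j * s) (sym (+-assoc s s (i * s))) (*-monoˡ-≤ s 2+i≤j))

      last-chordless : ∀ i → 2 + i ≤ q → ¬ P (t ∸ suc i * s)
      last-chordless i 2+i≤q = gap (t ∸ suc i * s) (m+n≤o⇒m≤o∸n (suc s) m+is≤t)
        (∸-monoʳ-< (≤-trans 0<s (m≤m+n s (i * s)))
          (<⇒≤ (≤-<-trans (*-monoˡ-≤ s (≤-trans (n≤1+n (suc i)) 2+i≤q)) qs<t)))
        where
        m+is≤t : suc s + suc i * s ≤ t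
        m+is≤t = ≤-trans (s≤s (*-monoˡ-≤ s 2+i≤q)) qs<t

      chordless : ∀ i j → 2 + i ≤ j → j ≤ suc q → (i ≡ 0 → j ≢ suc q) → ¬ P (w j ∸ w i)
      chordless i j 2+i≤j j≤r not-closing with m≤n⇒m<n∨m≡n j≤r
      ... | inj₁ (s≤s j≤q) = subst (λ x → ¬ P x)
              (sym (cong₂ _∸_ (w-inner j≤q) (w-inner (≤-trans (m≤n+m i 2) (≤-trans 2+i≤j j≤q)))))
              (inner-chordless i j 2+i≤j j≤q)
      ... | inj₂ refl with i
      ...   | zero = ⊥-elim (not-closing refl refl)
      ...   | suc i = subst (λ x → ¬ P x)
              (sym (cong₂ _∸_ w-last (w-inner (≤-trans (n≤1+n _) (≤-pred 2+i≤j)))))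
              (last-chordless i (≤-pred 2+i≤j))

  module _ (acyclic : NoChordlessCycle) where

    -- Below a gap [m, t) with t < 2m, the square 0, t-m, m, t is a chordless
    -- cycle unless t ∉ P: its sides t-m, 2m-t lie in [1, m), its diagonals are m.
    short-gap : ∀ {m t} → m < t → t < m + m → t < k → Below m → Gap m t → ¬ P t
    short-gap {m} {t} m<t t<2m t<k below gap Pt = acyclic 3 ≤-refl w cycle
      where
      e = t ∸ m
      0<e : 0 < e
      0<e = m<n⇒0<n∸m m<t
      e<m : e < m
      e<m = +-cancelʳ-< m e m (subst (_< m + m) (sym (m∸n+n≡m (<⇒≤ m<t))) t<2m)
      w : ℕ → ℕ
      w 0 = 0
      w 1 = e
      w 2 = m
      w _ = t
      increasing : ∀ i → i < 3 → w i < w (suc i)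
      increasing 0 _ = 0<e
      increasing 1 _ = e<m
      increasing 2 _ = m<t
      increasing (suc (suc (suc _))) (s≤s (s≤s (s≤s ())))
      edge : ∀ i → i < 3 → P (w (suc i) ∸ w i)
      edge 0 _ = below e 0<e e<m
      edge 1 _ = below (m ∸ e) (m<n⇒0<n∸m e<m) (∸-monoʳ-< 0<e (<⇒≤ e<m))
      edge 2 _ = below e 0<e e<m
      edge (suc (suc (suc _))) (s≤s (s≤s (s≤s ())))
      t∸e≡m : t ∸ e ≡ m
      t∸e≡m = m∸[m∸n]≡n (<⇒≤ m<t)
      ¬Pm : ¬ P m
      ¬Pm = gap m ≤-refl m<t
      cycle : ChordlessCycle 3 w
      cycle = record
        { starts-at-0 = refl ; increasing = increasing ; bounded = t<k ; edge = edge ; closing = Pt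
        ; chordless = square-chordless w ¬Pm (subst (λ x → ¬ P x) (sym t∸e≡m) ¬Pm) }

    -- Below a gap [m, t) with m = s + 1 and t ≥ 2m, the run 0, s, 2s, …, qs, t
    -- (q = ⌊(t-1)/s⌋ ≥ 2) is a chordless cycle unless t ∉ P.
    long-gap : ∀ {s t} .{{_ : NonZero s}} → suc s + suc s ≤ t → t < k →
      Below (suc s) → Gap (suc s) t → ¬ P t
    long-gap {s} {suc t'} 2m≤t t<k below gap Pt = acyclic (suc q) (s≤s 2≤q) w cycle
      where
      m = suc s
      t = suc t'
      q = t' / s
      qs<t : q * s < t
      qs<t = s≤s (m/n*n≤m t' s)
      t≤s+qs : t ≤ s + q * s
      t≤s+qs = subst (_< s + q * s) (sym (m≡m%n+[m/n]*n t' s)) (+-monoˡ-< (q * s) (m%n<n t' s))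
      2≤q : 2 ≤ q
      2≤q with 2 ≤? q
      ... | yes 2≤q = 2≤q
      ... | no 2≰q = ⊥-elim (<⇒≱ t<m+m 2m≤t)
        where
        open ≤-Reasoning
        t<m+m : t < m + m
        t<m+m = begin-strict
          t           ≤⟨ t≤s+qs ⟩
          s + q * s   ≤⟨ +-monoʳ-≤ s (*-monoˡ-≤ s (≤-pred (≰⇒> 2≰q))) ⟩
          s + 1 * s   ≡⟨ cong (s +_) (*-identityˡ s) ⟩
          s + s       <⟨ +-mono-< (n<1+n s) (n<1+n s) ⟩
          m + m       ∎
      open Run s q t qs<t t≤s+qs
      cycle : ChordlessCycle (suc q) w
      cycle = record
        { starts-at-0 = refl ; increasing = increasing ; bounded = subst (_< k) (sym w-last) t<k
        ; edge = edge below gap ; closing = subst P (sym w-last) Pt ; chordless = chordless below gap }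

    gap-closes : ∀ {m t} → 2 ≤ m → m < t → t < k → Below m → Gap m t → ¬ P t
    gap-closes {suc (suc s')} {t} _ m<t t<k below gap with t <? suc (suc s') + suc (suc s')
    ... | yes t<2m = short-gap m<t t<2m t<k below gap
    ... | no t≮2m = long-gap {suc s'} (≮⇒≥ t≮2m) t<k below gap
    gap-closes {suc zero} (s≤s ())

    -- once m ≥ 2 is the first index missing from P, no index in (m, k) is in P:
    -- by strong induction, the least such index would close the gap [m, t)
    beyond-first-gap : ∀ {m} → 2 ≤ m → Below m → ¬ P m → ∀ t → m < t → t < k → ¬ P t
    beyond-first-gap {m} 2≤m below ¬Pm = <-rec (λ t → m < t → t < k → ¬ P t) step
      where
      step : ∀ t → (∀ {u} → u < t → m < u → u < k → ¬ P u) → m < t → t < k → ¬ P t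
      step t earlier m<t t<k = gap-closes 2≤m m<t t<k below gap
        where
        gap : Gap m t
        gap i m≤i i<t with m≤n⇒m<n∨m≡n m≤i
        ... | inj₁ m<i = earlier i<t m<i (<-trans i<t t<k)
        ... | inj₂ refl = ¬Pm

    module _ (P1 : P 1) (Pk-1 : P (k ∸ 1)) where

      -- the first index m missing from P cannot be 1, nor k-1, nor lie strictly
      -- between them (then k-1 ∈ P would contradict beyond-first-gap)
      next-index : ∀ m → 1 ≤ m → m < k → Below m → ¬ ¬ P m
      next-index 1 _ _ _ ¬P1 = ¬P1 P1
      next-index m@(suc (suc _)) _ m<k below ¬Pm with m <? k ∸ 1
      ... | yes m<k-1 = beyond-first-gap (s≤s (s≤s z≤n)) below ¬Pm (k ∸ 1) m<k-1 k-1<k Pk-1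
        where
        k-1<k : k ∸ 1 < k
        k-1<k = ∸-monoʳ-< (s≤s z≤n) (≤-trans (s≤s z≤n) m<k)
      ... | no m≮k-1 = ¬Pm (subst P (sym (≤-antisym (<⇒≤pred m<k) (≮⇒≥ m≮k-1))) Pk-1)

      below-all : ∀ m → m < k → ¬ ¬ Below (suc m)
      below-all zero _ ¬below = ¬below (λ i 1≤i i<1 → ⊥-elim (<⇒≱ i<1 1≤i))
      below-all (suc m) m+1<k ¬below = below-all m (<-trans (n<1+n m) m+1<k) λ below →
        next-index (suc m) (s≤s z≤n) m+1<k below (λ Pm+1 → ¬below (extend below Pm+1))

      every-index-in-P : ∀ j → 1 ≤ j → j < k → ¬ ¬ P j
      every-index-in-P j 1≤j j<k ¬Pj = below-all j j<k (λ below → ¬Pj (below j 1≤j ≤-refl))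

module Multiples (n : ℕ) .{{_ : NonZero n}} (a : ℕ) where
  open CircularDistance n

  vertex : ℕ → ℕ
  vertex δ = (δ * a) % n

  -- |δa|ₙ: vertices whose indices differ by δ are adjacent iff S (offset δ)
  offset : ℕ → ℕ
  offset δ = wrap (vertex δ)

  mod-absorb : ∀ u {v} → n ∣ v → (u + v) % n ≡ u % n
  mod-absorb u (divides-refl c) = [m+kn]%n≡m%n u c n

  cdist-vertices : ∀ {x y} → x ≤ y → cdist n (vertex x) (vertex y) ≡ offset (y ∸ x)
  cdist-vertices {x} {y} x≤y =
    trans (cong (cdist n (vertex x)) vertex-y)
          (cdist-rotate (vertex x) (vertex (y ∸ x)) (m%n<n (x * a) n) (m%n<n ((y ∸ x) * a) n))
    where
    open ≡-Reasoning
    vertex-y : vertex y ≡ (vertex x + vertex (y ∸ x)) % n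
    vertex-y = begin
      (y * a) % n                ≡⟨ cong (λ z → (z * a) % n) (sym (m+[n∸m]≡n x≤y)) ⟩
      ((x + (y ∸ x)) * a) % n    ≡⟨ cong (_% n) (*-distribʳ-+ a x (y ∸ x)) ⟩
      (x * a + (y ∸ x) * a) % n  ≡⟨ %-distribˡ-+ (x * a) ((y ∸ x) * a) n ⟩
      (vertex x + vertex (y ∸ x)) % n ∎

  offset-generator : 0 < a → a + a ≤ n → offset 1 ≡ a
  offset-generator 0<a 2a≤n = begin
    wrap ((1 * a) % n) ≡⟨ cong (λ z → wrap (z % n)) (*-identityˡ a) ⟩
    wrap (a % n)       ≡⟨ cong wrap (m<n⇒m%n≡m (<-≤-trans (m<m+n a 0<a) 2a≤n)) ⟩
    wrap a             ≡⟨ wrap-small a 2a≤n ⟩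
    a                  ∎
    where open ≡-Reasoning

  module _ {k : ℕ} (n∣ka : n ∣ k * a) where

    offset-reflect : ∀ {j} → j ≤ k → offset (k ∸ j) ≡ offset j
    offset-reflect {j} j≤k = begin
      offset (k ∸ j)                  ≡⟨ sym (cdist-vertices j≤k) ⟩
      cdist n (vertex j) (vertex k)   ≡⟨ cong (cdist n (vertex j)) (n∣m⇒m%n≡0 (k * a) n n∣ka) ⟩
      cdist n (vertex j) 0            ≡⟨ trans (cdist-sym (vertex j) 0) (cdist-from-0 (vertex j)) ⟩
      offset j                        ∎
      where open ≡-Reasoning

    offset-mod : .{{_ : NonZero k}} → ∀ x → offset (x % k) ≡ offset x
    offset-mod x = cong wrap (begin
      ((x % k) * a) % n                         ≡⟨ sym (mod-absorb ((x % k) * a) (∣n⇒∣m*n (x / k) n∣ka)) ⟩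
      ((x % k) * a + (x / k) * (k * a)) % n     ≡⟨ cong (λ z → ((x % k) * a + z) % n) (sym (*-assoc (x / k) k a)) ⟩
      ((x % k) * a + (x / k) * k * a) % n       ≡⟨ cong (_% n) (sym (*-distribʳ-+ a (x % k) ((x / k) * k))) ⟩
      ((x % k + (x / k) * k) * a) % n           ≡⟨ cong (λ z → (z * a) % n) (sym (m≡m%n+[m/n]*n x k)) ⟩
      (x * a) % n                               ∎)
      where open ≡-Reasoning

  chordal⇒no-index-cycle : (S : ℕ → Set) (k : ℕ) → (∀ z → 0 < z → z < k → vertex z ≢ 0) →
    Chordal n S → IndexCycles.NoChordlessCycle (λ δ → S (offset δ)) k
  chordal⇒no-index-cycle S k distinct chordal r 3≤r w cycle =
    chord-free (chordal (suc r) (s≤s 3≤r) v (v<n , v-injective , v-adjacent))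
    where
    open IndexCycles.ChordlessCycle cycle
    v : ℕ → ℕ
    v i = vertex (w i)
    v<n : ∀ i → i < suc r → v i < n
    v<n i _ = m%n<n (w i * a) n
    w-increasing : ∀ {i j} → i < j → j ≤ r → w i < w j
    w-increasing = step-increasing⇒increasing w r increasing
    w-monotone : ∀ {i j} → i ≤ j → j ≤ r → w i ≤ w j
    w-monotone i≤j j≤r with m≤n⇒m<n∨m≡n i≤j
    ... | inj₁ i<j = <⇒≤ (w-increasing i<j j≤r)
    ... | inj₂ refl = ≤-refl
    distance : ∀ {i j} → i ≤ j → j ≤ r → cdist n (v i) (v j) ≡ offset (w j ∸ w i)
    distance i≤j j≤r = cdist-vertices (w-monotone i≤j j≤r)
    v-distinct : ∀ {i j} → i < j → j ≤ r → v i ≢ v j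
    v-distinct {i} {j} i<j j≤r vi≡vj =
      distinct (w j ∸ w i) (m<n⇒0<n∸m (w-increasing i<j j≤r)) difference<k
        (wrap-zero (vertex (w j ∸ w i)) (m%n<n _ n) offset≡0)
      where
      difference<k : w j ∸ w i < k
      difference<k = ≤-<-trans (m∸n≤m (w j) (w i)) (≤-<-trans (w-monotone j≤r ≤-refl) bounded)
      offset≡0 : offset (w j ∸ w i) ≡ 0
      offset≡0 = trans (sym (distance (<⇒≤ i<j) j≤r))
                   (trans (cong (cdist n (v i)) (sym vi≡vj)) (cdist-self (v i)))
    v-injective : ∀ i j → i < suc r → j < suc r → v i ≡ v j → i ≡ j
    v-injective i j (s≤s i≤r) (s≤s j≤r) vi≡vj with <-cmp i j
    ... | tri< i<j _ _ = ⊥-elim (v-distinct i<j j≤r vi≡vj)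
    ... | tri≈ _ i≡j _ = i≡j
    ... | tri> _ _ j<i = ⊥-elim (v-distinct j<i i≤r (sym vi≡vj))
    v-adjacent : ∀ i j → i < suc r → j < suc r → Consec (suc r) i j → Adj n S (v i) (v j)
    v-adjacent i .(suc i) _ (s≤s i+1≤r) (inj₁ refl) =
      subst S (sym (distance (n≤1+n i) i+1≤r)) (edge i i+1≤r)
    v-adjacent .r .0 _ _ (inj₂ (refl , refl)) =
      subst S (sym (trans (cdist-sym (v r) (v 0)) (distance z≤n ≤-refl)))
        (subst (λ x → S (offset (w r ∸ x))) (sym starts-at-0) closing)
    no-chord-between : ∀ {i j} → i < j → j < suc r →
      ¬ Consec (suc r) i j → ¬ Consec (suc r) j i → ¬ Adj n S (v i) (v j)
    no-chord-between {i} {j} i<j (s≤s j≤r) ¬i→j ¬j→i adjacent =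
      chordless i j (≤∧≢⇒< i<j (λ i+1≡j → ¬i→j (inj₁ (sym i+1≡j)))) j≤r
        (λ i≡0 j≡r → ¬j→i (inj₂ (j≡r , i≡0)))
        (subst S (distance (<⇒≤ i<j) j≤r) adjacent)
    chord-free : ¬ HasChord n S (suc r) v
    chord-free (i , j , i<r+1 , j<r+1 , i≢j , ¬i→j , ¬j→i , adjacent) with <-cmp i j
    ... | tri≈ _ i≡j _ = i≢j i≡j
    ... | tri< i<j _ _ = no-chord-between i<j j<r+1 ¬i→j ¬j→i adjacent
    ... | tri> _ _ j<i = no-chord-between j<i i<r+1 ¬j→i ¬i→j (subst S (cdist-sym (v i) (v j)) adjacent)

module Order (n a : ℕ) .{{_ : NonZero n}} where
  open CircularDistance n
  open Multiples n a

  n≡ord*gcd : n ≡ ord n a * gcd a n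
  n≡ord*gcd = _∣_.equality (gcd[m,n]∣n a n)

  instance
    gcd-nonZero : NonZero (gcd a n)
    gcd-nonZero = ≢-nonZero λ d≡0 →
      ≢-nonZero⁻¹ n (trans n≡ord*gcd (trans (cong (ord n a *_) d≡0) (*-zeroʳ (ord n a))))

  n∣ord*a : n ∣ ord n a * a
  n∣ord*a = subst (_∣ ord n a * a) (sym n≡ord*gcd) (*-monoʳ-∣ (ord n a) (gcd[m,n]∣m a n))

  -- za ≡ 0 (mod n) forces ord(a) ∣ z, since then n ∣ gcd(za, zn) = z·gcd(a, n)
  ord-divides : ∀ z → n ∣ z * a → ord n a ∣ z
  ord-divides z n∣za = *-cancelʳ-∣ (gcd a n) (subst (_∣ z * gcd a n) n≡ord*gcd n∣z*gcd)
    where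
    n∣z*gcd : n ∣ z * gcd a n
    n∣z*gcd = subst (n ∣_) (sym (c*gcd[m,n]≡gcd[cm,cn] z a n)) (gcd-greatest n∣za (n∣m*n z))

  below-ord : ∀ z → 0 < z → z < ord n a → vertex z ≢ 0
  below-ord z 0<z z<k vertex≡0 =
    <⇒≱ z<k (∣⇒≤ {{>-nonZero 0<z}} (ord-divides z (m%n≡0⇒n∣m (z * a) n vertex≡0)))

  -- by Bézout, gcd(a, n) ≡ ±xa (mod n) for some x, so |xa|ₙ = |gcd(a, n)|ₙ
  gcd-multiple : gcd a n < n → ∃[ x ] offset x ≡ wrap (gcd a n)
  gcd-multiple d<n with Bézout.identity (gcd-GCD a n)
  ... | Bézout.+- x y d+yn≡xa = x , cong wrap (begin
      (x * a) % n          ≡⟨ cong (_% n) (sym d+yn≡xa) ⟩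
      (d + y * n) % n      ≡⟨ [m+kn]%n≡m%n d y n ⟩
      d % n                ≡⟨ m<n⇒m%n≡m d<n ⟩
      d                    ∎)
    where
    open ≡-Reasoning
    d = gcd a n
  ... | Bézout.-+ x y d+xa≡yn = x , (begin
      wrap (vertex x)                         ≡⟨ sym (cdist-from-0 (vertex x)) ⟩
      cdist n 0 (vertex x)                    ≡⟨ cdist-sym 0 (vertex x) ⟩
      cdist n (vertex x) 0                    ≡⟨ cong (cdist n (vertex x)) (sym returns-to-0) ⟩
      cdist n (vertex x) ((vertex x + d) % n) ≡⟨ cdist-rotate (vertex x) d (m%n<n (x * a) n) d<n ⟩
      wrap d                                  ∎)
    where
    open ≡-Reasoning
    d = gcd a n
    returns-to-0 : (vertex x + d) % n ≡ 0
    returns-to-0 = begin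
      (vertex x + d) % n       ≡⟨ cong (λ z → (vertex x + z) % n) (sym (m<n⇒m%n≡m d<n)) ⟩
      (vertex x + d % n) % n   ≡⟨ sym (%-distribˡ-+ (x * a) d n) ⟩
      (x * a + d) % n          ≡⟨ cong (_% n) (trans (+-comm (x * a) d) d+xa≡yn) ⟩
      (y * n) % n              ≡⟨ m*n%n≡0 y n ⟩
      0                        ∎

  -- reducing x modulo ord(a) ≥ 2 gives an index j ∈ [1, ord(a)) with |ja|ₙ = gcd(a, n)
  gcd-index : 2 ≤ ord n a → Σ[ j ∈ ℕ ] 1 ≤ j × j < ord n a × offset j ≡ gcd a n
  gcd-index 2≤k = j , 1≤j , m%n<n x k , offset-j
    where
    instance
      k-nonZero : NonZero (ord n a)
      k-nonZero = >-nonZero (≤-trans (s≤s z≤n) 2≤k)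
    k = ord n a
    d = gcd a n
    0<d : 0 < d
    0<d = >-nonZero⁻¹ d
    2d≤n : d + d ≤ n
    2d≤n = subst₂ _≤_ (cong (d +_) (+-identityʳ d)) (sym n≡ord*gcd) (*-monoˡ-≤ d 2≤k)
    multiple : ∃[ x ] offset x ≡ wrap d
    multiple = gcd-multiple (<-≤-trans (m<m+n d 0<d) 2d≤n)
    x = proj₁ multiple
    j = x % k
    offset-j : offset j ≡ d
    offset-j = trans (offset-mod {k} n∣ord*a x) (trans (proj₂ multiple) (wrap-small d 2d≤n))
    1≤j : 1 ≤ j
    1≤j = n≢0⇒n>0 λ j≡0 →
      >⇒≢ 0<d (trans (sym offset-j) (trans (cong offset j≡0) (cong wrap (m*n%n≡0 0 n))))

-- With D = {δ : |δa|ₙ ∈ S}: chordality excludes chordless index cycles below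
-- k = ord(a), a ∈ S puts 1 and k-1 into D, so the index j of gcd(a, n) is in D.
corollary2p3 : (n : ℕ) → 1 ≤ n → (S : ℕ → Set) → S ⊆T n →
    (Σ ℕ λ a → S a × 4 ≤ ord n a × ¬ S (gcd a n)) →
    ¬ Chordal n S
corollary2p3 zero () _ _ _
corollary2p3 n@(suc _) _ S S⊆T (a , a∈S , 4≤k , gcd∉S) chordal
  with Order.gcd-index n a (≤-trans (s≤s (s≤s z≤n)) 4≤k)
... | j , 1≤j , j<k , offset-j =
  every-index-in-P no-index-cycle P1 Pk-1 j 1≤j j<k (λ Pj → gcd∉S (subst S offset-j Pj))
  where
  open Multiples n a
  k = ord n a
  open IndexCycles (λ δ → S (offset δ)) k
  no-index-cycle : NoChordlessCycle
  no-index-cycle = chordal⇒no-index-cycle S k (Order.below-ord n a) chordal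
  P1 : S (offset 1)
  P1 = subst S (sym (offset-generator (proj₁ (S⊆T a a∈S)) (≤half⇒double≤ (proj₂ (S⊆T a a∈S))))) a∈S
  Pk-1 : S (offset (k ∸ 1))
  Pk-1 = subst S (sym (offset-reflect (Order.n∣ord*a n a) (≤-trans (s≤s z≤n) 4≤k))) P1
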